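{- In a multipass pairing heap, if a delete-min does $k$ links, at least $k/2-1$ of them are good.
   Context: In a multipass pairing heap (a heap-ordered tree; see the canonical framework: linking two roots makes the one of smaller key, the winner, the parent of the other, the loser), a delete-min deletes the root, makes its children a list of roots, and does repeated pairing passes until one root remains; a pairing pass links the first root with the second, the third with the fourth, and so on, leaving the rightmost root unlinked if the number of roots is odd. Consider any sequence of heap operations. A node is temporary if it is eventually deleted by some delete-min in the sequence, and permanent otherwise. A link done during a delete-min is good if its loser is temporary or its winner is permanent, and bad otherwise. -}

module Defs where

open import Data.Nat using (ℕ; zero; suc; _+_; _≤ᵇ_)
open import Data.Bool using (Bool; true; false; if_then_else_; _∨_; not)
open import Data.List using (List; []; _∷_; _++_; length)
open import Data.Product using (_×_; _,_; proj₁; proj₂)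

-- A heap node: its key, and whether it is temporary (true) or permanent (false),
-- i.e. whether it is eventually deleted by some delete-min of the sequence.
record Node : Set where
  constructor mkNode
  field
    key       : ℕ
    temporary : Bool
open Node public

data Tree : Set where
  tnode : Node → List Tree → Tree

rootOf : Tree → Node
rootOf (tnode x _) = x

-- A link, recorded as (winner , loser).
Link : Set
Link = Node × Node

link : Tree → Tree → Tree × Link
link (tnode x xs) (tnode y ys) =
  if key x ≤ᵇ key y
  then (tnode x (tnode y ys ∷ xs) , (x , y))
  else (tnode y (tnode x xs ∷ ys) , (y , x))

isGood : Link → Bool
isGood (w , l) = temporary l ∨ not (temporary w)

countGood : List Link → ℕ
countGood [] = 0
countGood (l ∷ ls) = (if isGood l then 1 else 0) + countGood ls

pairingPass : List Tree → List Tree × List Link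
pairingPass (a ∷ b ∷ rs) with link a b | pairingPass rs
... | (w , l) | (rs' , ls) = (w ∷ rs' , l ∷ ls)
pairingPass rs = (rs , [])

-- The fuel argument
-- only serves termination: started with fuel = number of roots it never runs
-- out, since every pass on ≥ 2 roots strictly decreases the number of roots.
multipassF : ℕ → List Tree → List Tree × List Link
multipassF zero ts = (ts , [])
multipassF (suc n) [] = ([] , [])
multipassF (suc n) (t ∷ []) = (t ∷ [] , [])
multipassF (suc n) (a ∷ b ∷ rs) with pairingPass (a ∷ b ∷ rs)
... | (ts' , ls₁) with multipassF n ts'
...   | (res , ls₂) = (res , ls₁ ++ ls₂)

multipass : List Tree → List Tree × List Link
multipass ts = multipassF (length ts) ts

deleteMinLinks : Tree → List Link
deleteMinLinks (tnode _ ts) = proj₂ (multipass ts)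

{-# OPTIONS --safe #-}
module Submission where

-- A bad link has a permanent loser and a temporary winner, so it turns a
-- permanent root into a temporary one: the number of permanent roots is a
-- potential that pays for every bad link.  Hence the bad links done after the
-- first pairing pass are at most the permanent roots that pass leaves, and
-- each first-pass link contributes at most one to "bad + permanent root".
-- So all bad links together number at most the ⌈r/2⌉ roots left by the first
-- pass, where r is the number of children of the deleted root, while the
-- delete-min does k = r - 1 links in total; thus 2 * bad ≤ k + 2.

open import Defs
open import Data.Nat using (ℕ; suc; _≤_; _+_; _*_; _≤ᵇ_; z≤n; s≤s; s≤s⁻¹)
open import Data.Nat.Properties
open import Algebra.Properties.CommutativeSemigroup +-commutativeSemigroup using (interchange)
open import Data.Bool using (true; false; if_then_else_)
open import Data.List using (List; []; _∷_; _++_; length)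
open import Data.List.Properties using (length-++)
open import Data.Product using (_,_; proj₁; proj₂)
open import Relation.Binary.PropositionalEquality using (_≡_; refl; sym; trans; cong; module ≡-Reasoning)

permanence : Node → ℕ
permanence x = if temporary x then 0 else 1

permanentRoots : List Tree → ℕ
permanentRoots []       = 0
permanentRoots (t ∷ ts) = permanence (rootOf t) + permanentRoots ts

badness : Link → ℕ
badness l = if isGood l then 0 else 1

countBad : List Link → ℕ
countBad []       = 0
countBad (l ∷ ls) = badness l + countBad ls

countGood+countBad≡length : ∀ ls → countGood ls + countBad ls ≡ length ls
countGood+countBad≡length []       = refl
countGood+countBad≡length (l ∷ ls) with isGood l
... | true  = cong suc (countGood+countBad≡length ls)
... | false = trans (+-suc (countGood ls) (countBad ls)) (cong suc (countGood+countBad≡length ls))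

countBad-++ : ∀ xs ys → countBad (xs ++ ys) ≡ countBad xs + countBad ys
countBad-++ []       ys = refl
countBad-++ (x ∷ xs) ys = trans (cong (badness x +_) (countBad-++ xs ys)) (sym (+-assoc (badness x) _ _))

length≤2*countGood+2 : ∀ ls → 2 * countBad ls ≤ length ls + 2 → length ls ≤ 2 * countGood ls + 2
length≤2*countGood+2 ls 2b≤k+2 = begin
  length ls          ≡⟨ sym (countGood+countBad≡length ls) ⟩
  g + b              ≤⟨ +-monoʳ-≤ g b≤g+2 ⟩
  g + (g + 2)        ≡⟨ sym (+-assoc g g 2) ⟩
  g + g + 2          ≡⟨ cong (_+ 2) (cong (g +_) (sym (+-identityʳ g))) ⟩
  2 * g + 2          ∎
  where
  open ≤-Reasoning
  g = countGood ls
  b = countBad ls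
  b≤g+2 : b ≤ g + 2
  b≤g+2 = +-cancelˡ-≤ b b (g + 2) (begin
    b + b              ≡⟨ cong (b +_) (sym (+-identityʳ b)) ⟩
    2 * b              ≤⟨ 2b≤k+2 ⟩
    length ls + 2      ≡⟨ cong (_+ 2) (sym (countGood+countBad≡length ls)) ⟩
    g + b + 2          ≡⟨ cong (_+ 2) (+-comm g b) ⟩
    b + g + 2          ≡⟨ +-assoc b g 2 ⟩
    b + (g + 2)        ∎)

badness≤permanence-loser : ∀ w l → badness (w , l) ≤ permanence l
badness≤permanence-loser (mkNode _ true)  (mkNode _ true)  = z≤n
badness≤permanence-loser (mkNode _ true)  (mkNode _ false) = s≤s z≤n
badness≤permanence-loser (mkNode _ false) (mkNode _ true)  = z≤n
badness≤permanence-loser (mkNode _ false) (mkNode _ false) = z≤n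

badness+permanence-winner≤1 : ∀ w l → badness (w , l) + permanence w ≤ 1
badness+permanence-winner≤1 (mkNode _ true)  (mkNode _ true)  = z≤n
badness+permanence-winner≤1 (mkNode _ true)  (mkNode _ false) = s≤s z≤n
badness+permanence-winner≤1 (mkNode _ false) (mkNode _ true)  = s≤s z≤n
badness+permanence-winner≤1 (mkNode _ false) (mkNode _ false) = s≤s z≤n

winner : Tree → Tree → Node
winner a b = proj₁ (proj₂ (link a b))

loser : Tree → Tree → Node
loser a b = proj₂ (proj₂ (link a b))

rootOf-link : ∀ a b → rootOf (proj₁ (link a b)) ≡ winner a b
rootOf-link (tnode x _) (tnode y _) with key x ≤ᵇ key y
... | true  = refl
... | false = refl

link-permanence : ∀ a b →
  permanence (winner a b) + permanence (loser a b) ≡ permanence (rootOf a) + permanence (rootOf b)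
link-permanence (tnode x _) (tnode y _) with key x ≤ᵇ key y
... | true  = refl
... | false = +-comm (permanence y) (permanence x)

link-bad+permanent≤permanent : ∀ a b →
  badness (proj₂ (link a b)) + permanence (rootOf (proj₁ (link a b)))
    ≤ permanence (rootOf a) + permanence (rootOf b)
link-bad+permanent≤permanent a b = begin
  badness (w , l) + permanence (rootOf (proj₁ (link a b)))
    ≡⟨ cong (λ r → badness (w , l) + permanence r) (rootOf-link a b) ⟩
  badness (w , l) + permanence w   ≤⟨ +-monoˡ-≤ (permanence w) (badness≤permanence-loser w l) ⟩
  permanence l + permanence w      ≡⟨ +-comm (permanence l) (permanence w) ⟩
  permanence w + permanence l      ≡⟨ link-permanence a b ⟩
  permanence (rootOf a) + permanence (rootOf b) ∎
  where
  open ≤-Reasoning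
  w = winner a b
  l = loser a b

link-bad+permanent≤1 : ∀ a b → badness (proj₂ (link a b)) + permanence (rootOf (proj₁ (link a b))) ≤ 1
link-bad+permanent≤1 a b rewrite rootOf-link a b = badness+permanence-winner≤1 (winner a b) (loser a b)

passRoots : List Tree → List Tree
passRoots ts = proj₁ (pairingPass ts)

passLinks : List Tree → List Link
passLinks ts = proj₂ (pairingPass ts)

pairingPass-length : ∀ ts → length (passLinks ts) + length (passRoots ts) ≡ length ts
pairingPass-length []           = refl
pairingPass-length (t ∷ [])     = refl
pairingPass-length (a ∷ b ∷ rs) =
  cong suc (trans (+-suc (length (passLinks rs)) _) (cong suc (pairingPass-length rs)))

passRoots≤length : ∀ ts → length (passRoots ts) ≤ length ts
passRoots≤length ts = ≤-trans (m≤n+m _ (length (passLinks ts))) (≤-reflexive (pairingPass-length ts))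

2*passRoots≤1+length : ∀ ts → 2 * length (passRoots ts) ≤ suc (length ts)
2*passRoots≤1+length []           = z≤n
2*passRoots≤1+length (t ∷ [])     = s≤s (s≤s z≤n)
2*passRoots≤1+length (a ∷ b ∷ rs) rewrite *-suc 2 (length (passRoots rs)) =
  s≤s (s≤s (2*passRoots≤1+length rs))

pairingPass-bad+permanent≤permanent : ∀ ts →
  countBad (passLinks ts) + permanentRoots (passRoots ts) ≤ permanentRoots ts
pairingPass-bad+permanent≤permanent []           = z≤n
pairingPass-bad+permanent≤permanent (t ∷ [])     = ≤-refl
pairingPass-bad+permanent≤permanent (a ∷ b ∷ rs) = begin
  (x + countBad (passLinks rs)) + (y + permanentRoots (passRoots rs))
    ≡⟨ interchange x _ y _ ⟩
  (x + y) + (countBad (passLinks rs) + permanentRoots (passRoots rs))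
    ≤⟨ +-mono-≤ (link-bad+permanent≤permanent a b) (pairingPass-bad+permanent≤permanent rs) ⟩
  (permanence (rootOf a) + permanence (rootOf b)) + permanentRoots rs
    ≡⟨ +-assoc (permanence (rootOf a)) _ _ ⟩
  permanentRoots (a ∷ b ∷ rs) ∎
  where
  open ≤-Reasoning
  x = badness (proj₂ (link a b))
  y = permanence (rootOf (proj₁ (link a b)))

permanence≤1 : ∀ x → permanence x ≤ 1
permanence≤1 (mkNode _ true)  = z≤n
permanence≤1 (mkNode _ false) = s≤s z≤n

pairingPass-bad+permanent≤length : ∀ ts →
  countBad (passLinks ts) + permanentRoots (passRoots ts) ≤ length (passRoots ts)
pairingPass-bad+permanent≤length []           = z≤n
pairingPass-bad+permanent≤length (t ∷ [])     = +-monoˡ-≤ 0 (permanence≤1 (rootOf t))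
pairingPass-bad+permanent≤length (a ∷ b ∷ rs) = begin
  (x + countBad (passLinks rs)) + (y + permanentRoots (passRoots rs))
    ≡⟨ interchange x _ y _ ⟩
  (x + y) + (countBad (passLinks rs) + permanentRoots (passRoots rs))
    ≤⟨ +-mono-≤ (link-bad+permanent≤1 a b) (pairingPass-bad+permanent≤length rs) ⟩
  suc (length (passRoots rs)) ∎
  where
  open ≤-Reasoning
  x = badness (proj₂ (link a b))
  y = permanence (rootOf (proj₁ (link a b)))

roots : ℕ → List Tree → List Tree
roots n ts = proj₁ (multipassF n ts)

links : ℕ → List Tree → List Link
links n ts = proj₂ (multipassF n ts)

multipassF-length : ∀ n ts → length (links n ts) + length (roots n ts) ≡ length ts
multipassF-length 0       ts           = refl
multipassF-length (suc n) []           = refl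
multipassF-length (suc n) (t ∷ [])     = refl
multipassF-length (suc n) (a ∷ b ∷ rs) = begin
  length (passLinks ts ++ links n ts') + length (roots n ts')
    ≡⟨ cong (_+ length (roots n ts')) (length-++ (passLinks ts)) ⟩
  (length (passLinks ts) + length (links n ts')) + length (roots n ts')
    ≡⟨ +-assoc (length (passLinks ts)) _ _ ⟩
  length (passLinks ts) + (length (links n ts') + length (roots n ts'))
    ≡⟨ cong (length (passLinks ts) +_) (multipassF-length n ts') ⟩
  length (passLinks ts) + length ts'
    ≡⟨ pairingPass-length ts ⟩
  length ts ∎
  where
  open ≡-Reasoning
  ts = a ∷ b ∷ rs
  ts' = passRoots ts

multipassF-bad≤permanent : ∀ n ts → countBad (links n ts) ≤ permanentRoots ts
multipassF-bad≤permanent 0       ts           = z≤n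
multipassF-bad≤permanent (suc n) []           = z≤n
multipassF-bad≤permanent (suc n) (t ∷ [])     = z≤n
multipassF-bad≤permanent (suc n) (a ∷ b ∷ rs) = begin
  countBad (passLinks ts ++ links n ts')        ≡⟨ countBad-++ (passLinks ts) _ ⟩
  countBad (passLinks ts) + countBad (links n ts')
    ≤⟨ +-monoʳ-≤ (countBad (passLinks ts)) (multipassF-bad≤permanent n ts') ⟩
  countBad (passLinks ts) + permanentRoots ts'  ≤⟨ pairingPass-bad+permanent≤permanent ts ⟩
  permanentRoots ts ∎
  where
  open ≤-Reasoning
  ts = a ∷ b ∷ rs
  ts' = passRoots ts

multipassF-roots≤1 : ∀ n ts → length ts ≤ n → length (roots n ts) ≤ 1
multipassF-roots≤1 0       []           _ = z≤n
multipassF-roots≤1 0       (_ ∷ _)      ()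
multipassF-roots≤1 (suc n) []           _ = z≤n
multipassF-roots≤1 (suc n) (t ∷ [])     _ = s≤s z≤n
multipassF-roots≤1 (suc n) (a ∷ b ∷ rs) h =
  multipassF-roots≤1 n (passRoots (a ∷ b ∷ rs)) (≤-trans (s≤s (passRoots≤length rs)) (s≤s⁻¹ h))

length≤1+links : ∀ n ts → length ts ≤ n → length ts ≤ suc (length (links n ts))
length≤1+links n ts h = begin
  length ts                                  ≡⟨ sym (multipassF-length n ts) ⟩
  length (links n ts) + length (roots n ts)  ≤⟨ +-monoʳ-≤ (length (links n ts)) (multipassF-roots≤1 n ts h) ⟩
  length (links n ts) + 1                    ≡⟨ +-comm (length (links n ts)) 1 ⟩
  suc (length (links n ts)) ∎
  where open ≤-Reasoning

multipassF-2*bad≤links+2 : ∀ n ts → length ts ≤ n → 2 * countBad (links n ts) ≤ length (links n ts) + 2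
multipassF-2*bad≤links+2 0       ts           _ = z≤n
multipassF-2*bad≤links+2 (suc n) []           _ = z≤n
multipassF-2*bad≤links+2 (suc n) (t ∷ [])     _ = z≤n
multipassF-2*bad≤links+2 (suc n) (a ∷ b ∷ rs) h = begin
  2 * countBad (links (suc n) ts)       ≤⟨ *-monoʳ-≤ 2 bad≤passRoots ⟩
  2 * length (passRoots ts)             ≤⟨ 2*passRoots≤1+length ts ⟩
  suc (length ts)                       ≤⟨ s≤s (length≤1+links (suc n) ts h) ⟩
  suc (suc (length (links (suc n) ts))) ≡⟨ +-comm 2 (length (links (suc n) ts)) ⟩
  length (links (suc n) ts) + 2 ∎
  where
  open ≤-Reasoning
  ts = a ∷ b ∷ rs
  ts' = passRoots ts
  bad≤passRoots : countBad (links (suc n) ts) ≤ length ts'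
  bad≤passRoots = begin
    countBad (passLinks ts ++ links n ts')           ≡⟨ countBad-++ (passLinks ts) _ ⟩
    countBad (passLinks ts) + countBad (links n ts')
      ≤⟨ +-monoʳ-≤ (countBad (passLinks ts)) (multipassF-bad≤permanent n ts') ⟩
    countBad (passLinks ts) + permanentRoots ts'     ≤⟨ pairingPass-bad+permanent≤length ts ⟩
    length ts' ∎

lemma4p3 : (h : Tree) →
    length (deleteMinLinks h) ≤ 2 * countGood (deleteMinLinks h) + 2
lemma4p3 (tnode _ ts) = length≤2*countGood+2 (links (length ts) ts) (multipassF-2*bad≤links+2 (length ts) ts ≤-refl)
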